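{- Let $i\ge 2$, let $T_i$ be the binomial tree with root $r_i$, and let $1\le t<i$. Then $T_i$ contains $2^{i-t-1}$ subtrees, each isomorphic to the binomial tree $T_t$, which are pairwise vertex-disjoint and pairwise non-adjacent, and none of which contains the root $r_i$.
   Context: The binomial tree $T_i$ with root $r_i$ is defined recursively: $T_1$ is a single vertex $r_1$; for $i>1$, $T_i$ consists of a new vertex $r_i$ together with one copy of $T_j$ for each $j<i$, with $r_i$ joined by an edge to the root of each such copy. Equivalently, for $i\ge 2$, $T_i$ is obtained from two copies of $T_{i-1}$ by joining their roots with an edge and declaring one of the two roots to be $r_i$. -}

module Defs where

open import Data.Nat using (ℕ; zero; suc; pred)
open import Data.Bool using (Bool; true; false)
open import Data.Vec using (Vec; []; _∷_; replicate)
open import Data.Product using (_×_)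
open import Relation.Binary.PropositionalEquality using (_≡_)

-- Binomial trees, via the doubling description:
-- T_{n+1} consists of two copies of T_n (first bit false / true), whose roots
-- are joined by an edge; the root of the false-copy is the new root.

BVertex : ℕ → Set
BVertex i = Vec Bool (pred i)

broot : (i : ℕ) → BVertex i
broot i = replicate (pred i) false

-- Adjacency in the binomial tree on bit strings of length n (= T_{n+1}).
data Adj : {n : ℕ} → Vec Bool n → Vec Bool n → Set where
  inside  : ∀ {n} (b : Bool) {u v : Vec Bool n} → Adj u v → Adj (b ∷ u) (b ∷ v)
  link-ft : ∀ {n} → Adj (false ∷ replicate n false) (true ∷ replicate n false)
  link-tf : ∀ {n} → Adj (true ∷ replicate n false) (false ∷ replicate n false)

-- A subtree of T_i isomorphic to T_t: an injective map of the vertices of T_t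
-- into T_i that preserves and reflects adjacency (so its image, with the
-- edges of T_i between image vertices, is a copy of T_t).
record SubtreeIso (t i : ℕ) : Set where
  field
    emb       : BVertex t → BVertex i
    injective : ∀ u v → emb u ≡ emb v → u ≡ v
    adj-pres  : ∀ u v → Adj u v → Adj (emb u) (emb v)
    adj-refl  : ∀ u v → Adj (emb u) (emb v) → Adj u v
open SubtreeIso public

module Submission where

-- For every prefix q of length n, the vertices  q ++ true ∷ u  with
-- u ranging over bit strings of length s form a copy of T_{s+1}: the edges
-- between them are exactly the edges of T_{s+1} on the tails u, because
-- every other edge of the tree touches an all-false tail.  The same
-- inversion of adjacency shows that copies with different prefixes are
-- disjoint and non-adjacent, and the marker bit `true` keeps every copy
-- away from the all-false root.  There are 2^n prefixes; with
-- i = n + s + 2 and t = s + 1 this gives the 2^(i-t-1) copies required.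

open import Defs
open import Data.Nat using (ℕ; _≤_; _<_; _∸_; _^_; suc; _+_; s≤s)
open import Data.Nat.Properties using (m∸n+n≡m; ∸-+-assoc; +-comm)
open import Data.Fin using (Fin; combine; finToFun; funToFin)
open import Data.Fin.Properties using (2↔Bool; funToFin-finToFin)
open import Data.Product using (Σ; _×_; _,_; proj₁; proj₂)
open import Data.Sum using (_⊎_; inj₁; inj₂)
open import Data.Bool using (Bool; true; false)
open import Data.Vec using (Vec; []; _∷_; _++_; replicate; head; tail; lookup; tabulate)
open import Data.Vec.Properties using (lookup∘tabulate; ∷-injectiveʳ; ++-injectiveˡ; ++-injectiveʳ)
open import Data.Empty using (⊥-elim)
open import Function using (_∘_)
open import Function.Bundles using (Inverse; Injection)
open import Function.Properties.Inverse using (↔⇒↣)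
open import Relation.Binary.PropositionalEquality
  using (_≡_; _≢_; _≗_; refl; sym; cong; cong₂; subst; module ≡-Reasoning)
open import Relation.Nullary using (¬_)

digits : (n : ℕ) → Fin (2 ^ n) → Fin n → Fin 2
digits n = finToFun {2} {n}

prefix : (n : ℕ) → Fin (2 ^ n) → Vec Bool n
prefix n k = tabulate (Inverse.to 2↔Bool ∘ digits n k)

funToFin-cong : ∀ {m n} {f g : Fin m → Fin n} → f ≗ g → funToFin f ≡ funToFin g
funToFin-cong {m = 0}     _   = refl
funToFin-cong {m = suc m} f≗g = cong₂ combine (f≗g Fin.zero) (funToFin-cong (f≗g ∘ Fin.suc))

prefix-injective : ∀ n k l → prefix n k ≡ prefix n l → k ≡ l
prefix-injective n k l eq = begin
  k                        ≡⟨ sym (funToFin-finToFin {n} k) ⟩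
  funToFin (digits n k)    ≡⟨ funToFin-cong same-digits ⟩
  funToFin (digits n l)    ≡⟨ funToFin-finToFin {n} l ⟩
  l                        ∎
  where
  open ≡-Reasoning
  to : Fin 2 → Bool
  to = Inverse.to 2↔Bool

  same-digits : digits n k ≗ digits n l
  same-digits j = Injection.injective (↔⇒↣ 2↔Bool) (begin
    to (digits n k j)     ≡⟨ sym (lookup∘tabulate _ j) ⟩
    lookup (prefix n k) j ≡⟨ cong (λ q → lookup q j) eq ⟩
    lookup (prefix n l) j ≡⟨ lookup∘tabulate _ j ⟩
    to (digits n l j)     ∎)

adj-inversion : ∀ {n} {x y : Vec Bool (suc n)} → Adj x y →
  (head x ≡ head y × Adj (tail x) (tail y)) ⊎ (head x ≢ head y × tail x ≡ replicate n false)
adj-inversion (inside b a) = inj₁ (refl , a)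
adj-inversion link-ft      = inj₂ ((λ ()) , refl)
adj-inversion link-tf      = inj₂ ((λ ()) , refl)

marked-not-root : ∀ {n m} (q : Vec Bool n) (u : Vec Bool m) → q ++ true ∷ u ≢ replicate _ false
marked-not-root []      u ()
marked-not-root (_ ∷ q) u eq = marked-not-root q u (cong tail eq)

marked-adj : ∀ {n m} (q q′ : Vec Bool n) {u v : Vec Bool m} →
  Adj (q ++ true ∷ u) (q′ ++ true ∷ v) → q ≡ q′ × Adj u v
marked-adj [] [] a with adj-inversion a
... | inj₁ (_ , a′)      = refl , a′
... | inj₂ (heads≢ , _) = ⊥-elim (heads≢ refl)
marked-adj (_ ∷ q) (_ ∷ q′) {u} a with adj-inversion a
... | inj₁ (heads≡ , a′) = let q≡q′ , u~v = marked-adj q q′ a′ in cong₂ _∷_ heads≡ q≡q′ , u~v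
... | inj₂ (_ , tail≡0)  = ⊥-elim (marked-not-root q u tail≡0)

prefix-adj : ∀ {n m} (q : Vec Bool n) {x y : Vec Bool m} → Adj x y → Adj (q ++ x) (q ++ y)
prefix-adj []      a = a
prefix-adj (b ∷ q) a = inside b (prefix-adj q a)

markedCopy : ∀ n s → Vec Bool n → SubtreeIso (suc s) (suc (n + suc s))
markedCopy n s q = record
  { emb       = λ u → q ++ true ∷ u
  ; injective = λ u v → ∷-injectiveʳ ∘ ++-injectiveʳ q q
  ; adj-pres  = λ u v → prefix-adj q ∘ inside true
  ; adj-refl  = λ u v a → proj₂ (marked-adj q q a)
  }

DisjointCopies : (c i t : ℕ) → Set
DisjointCopies c i t = Σ (Fin c → SubtreeIso t i) (λ S →
    (∀ k l → k ≢ l → ∀ u v → emb (S k) u ≢ emb (S l) v)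
  × (∀ k l → k ≢ l → ∀ u v → ¬ Adj (emb (S k) u) (emb (S l) v))
  × (∀ k u → emb (S k) u ≢ broot i))

markedCopies : ∀ n s → DisjointCopies (2 ^ n) (suc (n + suc s)) (suc s)
markedCopies n s =
    (λ k → markedCopy n s (prefix n k))
  , (λ k l k≢l u v → k≢l ∘ same-prefix k l ∘ ++-injectiveˡ (prefix n k) (prefix n l))
  , (λ k l k≢l u v → k≢l ∘ same-prefix k l ∘ proj₁ ∘ marked-adj (prefix n k) (prefix n l))
  , (λ k u → marked-not-root (prefix n k) u)
  where
  same-prefix : ∀ k l → prefix n k ≡ prefix n l → k ≡ l
  same-prefix = prefix-injective n

-- For t ≤ m, the bit-string length m splits as (m - t - 1) prefix bits,
-- one marker bit and t - 1 tail bits.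
length-split : ∀ m s → suc s ≤ m → m ∸ s ∸ 1 + suc s ≡ m
length-split m s s<m = begin
  m ∸ s ∸ 1 + suc s    ≡⟨ cong (_+ suc s) (∸-+-assoc m s 1) ⟩
  m ∸ (s + 1) + suc s  ≡⟨ cong (λ z → m ∸ z + suc s) (+-comm s 1) ⟩
  m ∸ suc s + suc s    ≡⟨ m∸n+n≡m s<m ⟩
  m                    ∎
  where open ≡-Reasoning

proposition3p2 : (i t : ℕ) → 2 ≤ i → 1 ≤ t → t < i →
    Σ (Fin (2 ^ (i ∸ t ∸ 1)) → SubtreeIso t i) (λ S →
    (∀ k l → k ≢ l → ∀ u v → emb (S k) u ≢ emb (S l) v)
    × (∀ k l → k ≢ l → ∀ u v → ¬ Adj (emb (S k) u) (emb (S l) v))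
    × (∀ k u → emb (S k) u ≢ broot i))
proposition3p2 (suc m) (suc s) _ _ (s≤s s<m) =
  subst (λ m′ → DisjointCopies (2 ^ (m ∸ s ∸ 1)) (suc m′) (suc s))
        (length-split m s s<m)
        (markedCopies (m ∸ s ∸ 1) s)
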